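{- Let $G_1=(V_1,E_1)$ and $G_2=(V_2,E_2)$ be finite, simple, connected graphs with disjoint vertex sets, and let $u_1\in V_1$, $u_2\in V_2$. Let $\mathcal{S}=\mathcal{S}(G_1,G_2;u_1,u_2)$ be the splice graph obtained from the disjoint union of $G_1$ and $G_2$ by identifying $u_1$ and $u_2$. For $i=1,2$ and each edge $f=xy\in E_i$ define $$m^i(f)=\begin{cases} m_x^i(f) & \text{if } d_{G_i}(x,u_i)>d_{G_i}(y,u_i),\\ m_y^i(f) & \text{if } d_{G_i}(x,u_i)<d_{G_i}(y,u_i),\\ 0 & \text{if } d_{G_i}(x,u_i)=d_{G_i}(y,u_i),\end{cases}$$ where $m_x^i(f)$ is the number of edges $g$ of $G_i$ with $d_{G_i}(g,x)<d_{G_i}(g,y)$ (and $m_y^i(f)$ analogously). Then $$Sz_e(\mathcal{S}) = Sz_e(G_1)+Sz_e(G_2) + |E_2|\sum_{f\in E_1} m^1(f) + |E_1|\sum_{f\in E_2} m^2(f).$$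
   Context: For a connected graph $G$, $d_G(x,y)$ denotes the distance between vertices $x,y$, and for an edge $g=ab$ and a vertex $u$, $d_G(g,u)=\min\{d_G(a,u),d_G(b,u)\}$. For an edge $e=uv$ of $G$, $m_u(e)$ is the number of edges $g$ of $G$ with $d_G(g,u)<d_G(g,v)$, and $m_v(e)$ is defined analogously. The edge-Szeged index is $Sz_e(G)=\sum_{e=uv\in E(G)} m_u(e)\,m_v(e)$. In the splice graph, the edge set is the disjoint union $E_1\cup E_2$. -}

module Defs where

open import Data.Bool using (Bool; true; false; _∧_; _∨_; if_then_else_; not)
open import Data.Nat using (ℕ; zero; suc; _+_; _*_; _⊓_; _<ᵇ_)
open import Data.Fin using (Fin)
import Data.Fin as F
open import Data.List using (List; []; _∷_; _++_; map; filter; length; allFin)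
open import Data.Nat.ListAction using (sum)
open import Data.Bool.ListAction using (any)
open import Data.Product using (_×_; _,_; ∃)
open import Data.Sum using (_⊎_; inj₁; inj₂)
open import Relation.Nullary using (does)
open import Relation.Binary.PropositionalEquality using (_≡_)
open import Data.List.Membership.Propositional using (_∈_)

bfilter : {A : Set} → (A → Bool) → List A → List A
bfilter p [] = []
bfilter p (x ∷ xs) = if p x then x ∷ bfilter p xs else bfilter p xs

-- A finite graph: an arbitrary vertex type with decidable equality,
-- a list enumerating the vertex set, and a Boolean adjacency relation
-- (only consulted between listed vertices).
record Graph : Set₁ where
  field
    V     : Set
    eq?   : (x y : V) → Bool
    verts : List V
    adj   : V → V → Bool

module _ (G : Graph) where
  open Graph G

  -- edges: unordered pairs {x,y} of listed vertices, each listed once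
  edgesFrom : List V → List (V × V)
  edgesFrom []       = []
  edgesFrom (x ∷ xs) = map (x ,_) (bfilter (adj x) xs) ++ edgesFrom xs

  edges : List (V × V)
  edges = edgesFrom verts

  within : ℕ → V → V → Bool
  within zero    x y = eq? x y
  within (suc k) x y = within k x y ∨ any (λ z → within k x z ∧ adj z y) verts

  search : (ℕ → Bool) → ℕ → ℕ → ℕ
  search p i zero     = i
  search p i (suc f)  = if p i then i else search p (suc i) f

  -- shortest-path distance d_G(x,y) (for connected G)
  dist : V → V → ℕ
  dist x y = search (λ k → within k x y) 0 (length verts)

  distE : V × V → V → ℕ
  distE (a , b) u = dist a u ⊓ dist b u

  mcount : V → V → ℕ
  mcount u v = length (bfilter (λ g → distE g u <ᵇ distE g v) edges)

  Sze : ℕ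
  Sze = sum (map (λ { (u , v) → mcount u v * mcount v u }) edges)

  mroot : V → V × V → ℕ
  mroot r (x , y) =
    if dist y r <ᵇ dist x r then mcount x y
    else (if dist x r <ᵇ dist y r then mcount y x else 0)

  Connected : Set
  Connected = ∀ x y → x ∈ verts → y ∈ verts → ∃ λ k → within k x y ≡ true

FinGraph : (n : ℕ) → (Fin n → Fin n → Bool) → Graph
FinGraph n a = record
  { V = Fin n ; eq? = λ x y → does (x F.≟ y) ; verts = allFin n ; adj = a }

Symmetric : {n : ℕ} → (Fin n → Fin n → Bool) → Set
Symmetric a = ∀ x y → a x y ≡ a y x

Irreflexive : {n : ℕ} → (Fin n → Fin n → Bool) → Set
Irreflexive a = ∀ x → a x x ≡ false

-- splice graph: disjoint union on Fin n₁ ⊎ Fin n₂, with inj₂ u₂ identified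
-- with inj₁ u₁ (inj₂ u₂ is dropped from the vertex list, and its
-- adjacencies are transferred to inj₁ u₁).
splice : (n₁ n₂ : ℕ) → (Fin n₁ → Fin n₁ → Bool) → (Fin n₂ → Fin n₂ → Bool)
       → Fin n₁ → Fin n₂ → Graph
splice n₁ n₂ a₁ a₂ u₁ u₂ = record
  { V = Fin n₁ ⊎ Fin n₂
  ; eq? = e
  ; verts = map inj₁ (allFin n₁) ++ map inj₂ (bfilter (λ x → not (does (x F.≟ u₂))) (allFin n₂))
  ; adj = ad }
  where
  e : Fin n₁ ⊎ Fin n₂ → Fin n₁ ⊎ Fin n₂ → Bool
  e (inj₁ x) (inj₁ y) = does (x F.≟ y)
  e (inj₂ x) (inj₂ y) = does (x F.≟ y)
  e _ _ = false
  ad : Fin n₁ ⊎ Fin n₂ → Fin n₁ ⊎ Fin n₂ → Bool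
  ad (inj₁ x) (inj₁ y) = a₁ x y
  ad (inj₂ x) (inj₂ y) = a₂ x y
  ad (inj₁ x) (inj₂ y) = does (x F.≟ u₁) ∧ a₂ u₂ y
  ad (inj₂ x) (inj₁ y) = a₂ x u₂ ∧ does (y F.≟ u₁)

module Submission where

-- Distances.  `dist` is a bounded breadth-first search, so we show that a
-- labelling with the breadth-first properties is the distance function
-- (`Walks.labelling-dist`) and that in a connected graph the search
-- succeeds within |V| - 1 steps (`Walks.Saturation`).  This gives the
-- metric facts for Gᵢ (`Metric`) and then d_S(v,w) = d₁(π₁ v, π₁ w) +
-- d₂(π₂ v, π₂ w), where πᵢ v is v itself or the cut vertex (`SpliceDistance`).
--
-- A symmetric edge weight of S sums to a sum over E₁ plus a sum over
-- E₂ (`Splice.edgeSum-splice`).  Applied to the indicators counted by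
-- m_v(e) and combined with the distance formula: m_v(e) in S is m_v(e) in
-- Gᵢ, plus |Eⱼ| when v is strictly closer to the cut vertex than the other
-- endpoint (`mcount-G₁-side`, `mcount-G₂-side`).
--
-- Algebra.  Expanding m_u(e) m_v(e) (`shifted-product`) and summing over
-- both sides gives the formula.

open import Defs
open import Data.Nat using (ℕ; zero; suc; _+_; _*_; _≤_; z≤n; s≤s; _<ᵇ_; pred; _≤?_)
open import Data.Nat.Properties hiding (eq?)
open import Data.Fin using (Fin) renaming (_≟_ to _≟F_)
import Data.Fin as Fin
open import Data.Bool using (Bool; true; false; T; _∧_; _∨_; if_then_else_; not)
open import Data.List using (List; []; _∷_; _++_; map; length; allFin)
open import Data.List.Properties using (length-tabulate; length-++; length-map; map-++; map-∘)
open import Data.Nat.ListAction using (sum)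
open import Data.Nat.ListAction.Properties using (sum-++)
open import Data.Nat.Tactic.RingSolver using (solve-∀)
open import Algebra.Properties.CommutativeSemigroup +-commutativeSemigroup using (interchange)
open import Data.Bool.ListAction using (any)
open import Data.List.Membership.Propositional using (_∈_)
open import Data.List.Membership.Propositional.Properties using (∈-allFin; ∈-map⁺; ∈-map⁻; ∈-++⁺ˡ; ∈-++⁺ʳ; ∈-++⁻)
open import Data.List.Relation.Unary.Unique.Propositional.Properties using (allFin⁺)
open import Data.List.Relation.Unary.Any using (here; there)
open import Data.List.Relation.Unary.All as All using (All)
open import Data.List.Relation.Unary.Unique.Propositional using (Unique)
open import Data.List.Relation.Unary.AllPairs using (_∷_)
open import Data.Product using (∃; _×_; _,_; proj₁; proj₂)
open import Data.Sum using (_⊎_; inj₁; inj₂)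
open import Data.Empty using (⊥-elim)
open import Data.Unit using (⊤; tt)
open import Relation.Nullary using (yes; no; does)
open import Relation.Binary.PropositionalEquality

true≢false : true ≢ false
true≢false ()

∨-true⁻ : ∀ b c → b ∨ c ≡ true → b ≡ true ⊎ c ≡ true
∨-true⁻ true  c _ = inj₁ refl
∨-true⁻ false c h = inj₂ h

∨-trueˡ : ∀ {b} c → b ≡ true → b ∨ c ≡ true
∨-trueˡ c refl = refl

∨-trueʳ : ∀ b {c} → c ≡ true → b ∨ c ≡ true
∨-trueʳ true  _ = refl
∨-trueʳ false h = h

∧-true⁻ : ∀ b c → b ∧ c ≡ true → b ≡ true × c ≡ true
∧-true⁻ true true _ = refl , refl

∧-true⁺ : ∀ {b c} → b ≡ true → c ≡ true → b ∧ c ≡ true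
∧-true⁺ refl refl = refl

any-true⁺ : ∀ {A : Set} (p : A → Bool) {xs : List A} {z : A} → z ∈ xs → p z ≡ true → any p xs ≡ true
any-true⁺ p (here refl) pz rewrite pz = refl
any-true⁺ p {x ∷ _} (there z∈xs) pz with p x
... | true  = refl
... | false = any-true⁺ p z∈xs pz

any-true⁻ : ∀ {A : Set} (p : A → Bool) (xs : List A) → any p xs ≡ true → ∃ λ z → z ∈ xs × p z ≡ true
any-true⁻ p (x ∷ xs) h with p x in px
... | true  = x , here refl , px
... | false = let (z , z∈xs , pz) = any-true⁻ p xs h in z , there z∈xs , pz

≟-true⁻ : ∀ {n} (x y : Fin n) → does (x ≟F y) ≡ true → x ≡ y
≟-true⁻ x y h with x ≟F y
... | yes x≡y = x≡y

≟-refl : ∀ {n} (x : Fin n) → does (x ≟F x) ≡ true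
≟-refl x with x ≟F x
... | yes _ = refl
... | no x≢x = ⊥-elim (x≢x refl)

bfilter-∈⁺ : ∀ {A : Set} (p : A → Bool) {x : A} xs → x ∈ xs → p x ≡ true → x ∈ bfilter p xs
bfilter-∈⁺ p (y ∷ xs) (here refl) px rewrite px = here refl
bfilter-∈⁺ p (y ∷ xs) (there x∈xs) px with p y
... | true  = there (bfilter-∈⁺ p xs x∈xs px)
... | false = bfilter-∈⁺ p xs x∈xs px

bfilter-∈⁻ : ∀ {A : Set} (p : A → Bool) {x : A} xs → x ∈ bfilter p xs → x ∈ xs × p x ≡ true
bfilter-∈⁻ p (y ∷ xs) x∈ with p y in py
bfilter-∈⁻ p (y ∷ xs) (here refl) | true = here refl , py
bfilter-∈⁻ p (y ∷ xs) (there x∈) | true = let (x∈xs , px) = bfilter-∈⁻ p xs x∈ in there x∈xs , px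
bfilter-∈⁻ p (y ∷ xs) x∈ | false = let (x∈xs , px) = bfilter-∈⁻ p xs x∈ in there x∈xs , px

bfilter-all : ∀ {A : Set} (p : A → Bool) xs → (∀ x → x ∈ xs → p x ≡ true) → bfilter p xs ≡ xs
bfilter-all p [] _ = refl
bfilter-all p (x ∷ xs) all rewrite all x (here refl) = cong (x ∷_) (bfilter-all p xs (λ y y∈ → all y (there y∈)))

length-bfilter≤ : ∀ {A : Set} (p : A → Bool) xs → length (bfilter p xs) ≤ length xs
length-bfilter≤ p [] = z≤n
length-bfilter≤ p (x ∷ xs) with p x
... | true  = s≤s (length-bfilter≤ p xs)
... | false = m≤n⇒m≤1+n (length-bfilter≤ p xs)

length-bfilter-mono : ∀ {A : Set} (p q : A → Bool) xs → (∀ x → x ∈ xs → p x ≡ true → q x ≡ true)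
                    → length (bfilter p xs) ≤ length (bfilter q xs)
length-bfilter-mono p q [] _ = z≤n
length-bfilter-mono p q (x ∷ xs) p⇒q with p x in px | q x in qx
... | true  | true  = s≤s (length-bfilter-mono p q xs (λ y y∈ → p⇒q y (there y∈)))
... | true  | false = ⊥-elim (true≢false (trans (sym (p⇒q x (here refl) px)) qx))
... | false | true  = m≤n⇒m≤1+n (length-bfilter-mono p q xs (λ y y∈ → p⇒q y (there y∈)))
... | false | false = length-bfilter-mono p q xs (λ y y∈ → p⇒q y (there y∈))

length-bfilter-rigid : ∀ {A : Set} (p q : A → Bool) xs → (∀ x → x ∈ xs → p x ≡ true → q x ≡ true)
                     → length (bfilter q xs) ≤ length (bfilter p xs)
                     → ∀ x → x ∈ xs → q x ≡ true → p x ≡ true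
length-bfilter-rigid p q (y ∷ xs) p⇒q le x x∈ qx with p y in py | q y in qy
length-bfilter-rigid p q (y ∷ xs) p⇒q le x (here refl) qx | true | _ = py
length-bfilter-rigid p q (y ∷ xs) p⇒q le x (there x∈) qx | true | true =
  length-bfilter-rigid p q xs (λ z z∈ → p⇒q z (there z∈)) (≤-pred le) x x∈ qx
length-bfilter-rigid p q (y ∷ xs) p⇒q le x x∈ qx | true | false =
  ⊥-elim (true≢false (trans (sym (p⇒q y (here refl) py)) qy))
length-bfilter-rigid p q (y ∷ xs) p⇒q le x x∈ qx | false | true =
  ⊥-elim (<-irrefl refl (≤-trans le (length-bfilter-mono p q xs (λ z z∈ → p⇒q z (there z∈)))))
length-bfilter-rigid p q (y ∷ xs) p⇒q le x (here refl) qx | false | false = ⊥-elim (true≢false (trans (sym qx) qy))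
length-bfilter-rigid p q (y ∷ xs) p⇒q le x (there x∈) qx | false | false =
  length-bfilter-rigid p q xs (λ z z∈ → p⇒q z (there z∈)) le x x∈ qx

length-bfilter-full : ∀ {A : Set} (p : A → Bool) xs → length xs ≤ length (bfilter p xs) → ∀ x → x ∈ xs → p x ≡ true
length-bfilter-full p (y ∷ xs) le x x∈ with p y in py
length-bfilter-full p (y ∷ xs) le x (here refl) | true = py
length-bfilter-full p (y ∷ xs) le x (there x∈) | true = length-bfilter-full p xs (≤-pred le) x x∈
length-bfilter-full p (y ∷ xs) le x x∈ | false = ⊥-elim (<-irrefl refl (≤-trans le (length-bfilter≤ p xs)))

length-bfilter-pos : ∀ {A : Set} (p : A → Bool) {x : A} xs → x ∈ xs → p x ≡ true → 1 ≤ length (bfilter p xs)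
length-bfilter-pos p (y ∷ xs) x∈ px with p y in py
... | true = s≤s z≤n
length-bfilter-pos p (y ∷ xs) (here refl) px | false = ⊥-elim (true≢false (trans (sym px) py))
length-bfilter-pos p (y ∷ xs) (there x∈) px | false = length-bfilter-pos p xs x∈ px

module Walks (G : Graph) where
  open Graph G

  W : ℕ → V → V → Bool
  W = within G

  W-suc : ∀ k x y → W k x y ≡ true → W (suc k) x y ≡ true
  W-suc k x y h = ∨-trueˡ _ h

  W-mono : ∀ {k m} x y → k ≤ m → W k x y ≡ true → W m x y ≡ true
  W-mono {m = zero}  x y z≤n h = h
  W-mono {m = suc m} x y k≤m h with m≤n⇒m<n∨m≡n k≤m
  ... | inj₁ k<m  = W-suc m x y (W-mono x y (≤-pred k<m) h)
  ... | inj₂ refl = h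

  W-suc⁻ : ∀ k x y → W (suc k) x y ≡ true
         → W k x y ≡ true ⊎ ∃ λ z → z ∈ verts × W k x z ≡ true × adj z y ≡ true
  W-suc⁻ k x y h with ∨-true⁻ (W k x y) _ h
  ... | inj₁ short = inj₁ short
  ... | inj₂ step with any-true⁻ _ verts step
  ... | z , z∈ , wz = let (xz , zy) = ∧-true⁻ (W k x z) (adj z y) wz in inj₂ (z , z∈ , xz , zy)

  W-step : ∀ k x y {z} → z ∈ verts → W k x z ≡ true → adj z y ≡ true → W (suc k) x y ≡ true
  W-step k x y z∈ xz zy = ∨-trueʳ (W k x y) (any-true⁺ (λ z → W k x z ∧ adj z y) z∈ (∧-true⁺ xz zy))

  search-correct : ∀ (p : ℕ → Bool) i f → p (i + f) ≡ true → p (search G p i f) ≡ true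
  search-correct p i zero    h rewrite +-identityʳ i = h
  search-correct p i (suc f) h with p i in pi
  ... | true  = pi
  ... | false = search-correct p (suc i) f (subst (λ t → p t ≡ true) (+-suc i f) h)

  search-least : ∀ (p : ℕ → Bool) i f j → i ≤ j → p j ≡ true → search G p i f ≤ j
  search-least p i zero    j i≤j _  = i≤j
  search-least p i (suc f) j i≤j pj with p i in pi
  ... | true  = i≤j
  ... | false = search-least p (suc i) f j (≤∧≢⇒< i≤j i≢j) pj
    where
    i≢j : i ≢ j
    i≢j refl = true≢false (trans (sym pj) pi)

  -- Such a labelling is the distance function from s (`labelling-dist`);
  -- this is how the distances of the splice graph are computed.
  record Labelling (s : V) (f : V → ℕ) : Set where
    field
      zero-at-source : ∀ y → y ∈ verts → eq? s y ≡ true → f y ≡ 0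
      source-at-zero : ∀ y → y ∈ verts → f y ≡ 0 → eq? s y ≡ true
      edge-step      : ∀ z y → z ∈ verts → y ∈ verts → adj z y ≡ true → f y ≤ suc (f z)
      predecessor    : ∀ y k → y ∈ verts → f y ≡ suc k → ∃ λ z → z ∈ verts × adj z y ≡ true × f z ≡ k
      bounded        : ∀ y → y ∈ verts → f y ≤ length verts

  module _ {s : V} {f : V → ℕ} (L : Labelling s f) where
    open Labelling L

    labelling-W⁻ : ∀ k y → y ∈ verts → W k s y ≡ true → f y ≤ k
    labelling-W⁻ zero    y y∈ h = ≤-reflexive (zero-at-source y y∈ h)
    labelling-W⁻ (suc k) y y∈ h with W-suc⁻ k s y h
    ... | inj₁ short = m≤n⇒m≤1+n (labelling-W⁻ k y y∈ short)
    ... | inj₂ (z , z∈ , sz , zy) = ≤-trans (edge-step z y z∈ y∈ zy) (s≤s (labelling-W⁻ k z z∈ sz))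

    labelling-W⁺ : ∀ k y → y ∈ verts → f y ≤ k → W k s y ≡ true
    labelling-W⁺ zero    y y∈ fy≤0 = source-at-zero y y∈ (n≤0⇒n≡0 fy≤0)
    labelling-W⁺ (suc k) y y∈ fy≤k+1 with m≤n⇒m<n∨m≡n fy≤k+1
    ... | inj₁ fy≤k = W-suc k s y (labelling-W⁺ k y y∈ (≤-pred fy≤k))
    ... | inj₂ fy≡k+1 with predecessor y k y∈ fy≡k+1
    ... | z , z∈ , zy , fz≡k = W-step k s y z∈ (labelling-W⁺ k z z∈ (≤-reflexive fz≡k)) zy

    labelling-dist : ∀ y → y ∈ verts → dist G s y ≡ f y
    labelling-dist y y∈ = ≤-antisym
      (search-least p 0 (length verts) (f y) z≤n (labelling-W⁺ (f y) y y∈ ≤-refl))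
      (labelling-W⁻ _ y y∈ (search-correct p 0 (length verts) (labelling-W⁺ (length verts) y y∈ (bounded y y∈))))
      where
      p : ℕ → Bool
      p k = W k s y

  -- The sets reached within k steps grow strictly until they stop
  -- growing once, and from then on they never change.
  module Saturation (s : V) (s∈ : s ∈ verts) (s-refl : eq? s s ≡ true)
                    (reachable : ∀ y → y ∈ verts → ∃ λ k → W k s y ≡ true) where
    reached : ℕ → ℕ
    reached k = length (bfilter (W k s) verts)

    Saturated : ℕ → Set
    Saturated j = ∀ y → y ∈ verts → W (suc j) s y ≡ true → W j s y ≡ true

    saturated-forever : ∀ j → Saturated j → ∀ m y → y ∈ verts → W m s y ≡ true → W j s y ≡ true
    saturated-forever j sat zero    y y∈ h = W-mono {m = j} s y z≤n h
    saturated-forever j sat (suc m) y y∈ h with W-suc⁻ m s y h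
    ... | inj₁ short = saturated-forever j sat m y y∈ short
    ... | inj₂ (z , z∈ , sz , zy) = sat y y∈ (W-step j s y z∈ (saturated-forever j sat m z z∈ sz) zy)

    saturated-or-growing : ∀ k → (∃ λ j → j ≤ k × Saturated j) ⊎ (suc k ≤ reached k)
    saturated-or-growing zero = inj₂ (length-bfilter-pos (W 0 s) verts s∈ s-refl)
    saturated-or-growing (suc k) with saturated-or-growing k
    ... | inj₁ (j , j≤k , sat) = inj₁ (j , m≤n⇒m≤1+n j≤k , sat)
    ... | inj₂ growing with reached (suc k) ≤? reached k
    ... | yes stuck = inj₁ (k , n≤1+n k ,
            length-bfilter-rigid (W k s) (W (suc k) s) verts (λ y _ → W-suc k s y) stuck)
    ... | no grows = inj₂ (≤-trans (s≤s growing) (≰⇒> grows))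

    saturation : ∀ m → length verts ≡ suc m → ∀ y → y ∈ verts → W m s y ≡ true
    saturation m |V|≡m+1 y y∈ with saturated-or-growing m
    ... | inj₁ (j , j≤m , sat) =
          W-mono s y j≤m (saturated-forever j sat (proj₁ (reachable y y∈)) y y∈ (proj₂ (reachable y y∈)))
    ... | inj₂ growing = length-bfilter-full (W m s) verts (subst (_≤ reached m) (sym |V|≡m+1) growing) y y∈

module Metric (n : ℕ) (a : Fin n → Fin n → Bool) (sym-a : Symmetric a)
              (conn : Connected (FinGraph n a)) (u : Fin n) where
  open Walks (FinGraph n a) public

  d : Fin n → Fin n → ℕ
  d = dist (FinGraph n a)

  |V|≡1+pred-n : length (allFin n) ≡ suc (pred n)
  |V|≡1+pred-n = trans (length-tabulate (λ x → x)) (nonempty u)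
    where
    nonempty : ∀ {m} → Fin m → m ≡ suc (pred m)
    nonempty Fin.zero    = refl
    nonempty (Fin.suc _) = refl

  W-everywhere : ∀ x y → W (pred n) x y ≡ true
  W-everywhere x y =
    Saturation.saturation x (∈-allFin x) (≟-refl x) (λ y y∈ → conn x y (∈-allFin x) y∈)
                          (pred n) |V|≡1+pred-n y (∈-allFin y)

  d-least : ∀ k x y → W k x y ≡ true → d x y ≤ k
  d-least k x y h = search-least (λ k → W k x y) 0 (length (allFin n)) k z≤n h

  d-realised : ∀ x y → W (d x y) x y ≡ true
  d-realised x y = search-correct (λ k → W k x y) 0 (length (allFin n))
    (W-mono x y (subst (pred n ≤_) (sym |V|≡1+pred-n) (n≤1+n _)) (W-everywhere x y))

  d-W : ∀ k x y → d x y ≤ k → W k x y ≡ true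
  d-W k x y le = W-mono x y le (d-realised x y)

  d-bound : ∀ x y → d x y ≤ pred n
  d-bound x y = d-least (pred n) x y (W-everywhere x y)

  d≡0⇒≡ : ∀ x y → d x y ≡ 0 → x ≡ y
  d≡0⇒≡ x y h = ≟-true⁻ x y (d-W 0 x y (≤-reflexive h))

  d-refl : ∀ x → d x x ≡ 0
  d-refl x = n≤0⇒n≡0 (d-least 0 x x (≟-refl x))

  d-edge : ∀ x z y → a z y ≡ true → d x y ≤ suc (d x z)
  d-edge x z y zy = d-least (suc (d x z)) x y (W-step (d x z) x y (∈-allFin z) (d-realised x z) zy)

  d-predecessor : ∀ x y k → d x y ≡ suc k → ∃ λ z → a z y ≡ true × d x z ≡ k
  d-predecessor x y k dxy≡k+1 with W-suc⁻ k x y (d-W (suc k) x y (≤-reflexive dxy≡k+1))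
  ... | inj₁ short = ⊥-elim (<-irrefl refl (subst (_≤ k) dxy≡k+1 (d-least k x y short)))
  ... | inj₂ (z , _ , xz , zy) =
        z , zy , ≤-antisym (d-least k x z xz) (≤-pred (subst (_≤ suc (d x z)) dxy≡k+1 (d-edge x z y zy)))

  W-prepend : ∀ k x z y → a x z ≡ true → W k z y ≡ true → W (suc k) x y ≡ true
  W-prepend zero x z y xz zy =
    W-step 0 x y (∈-allFin x) (≟-refl x) (subst (λ t → a x t ≡ true) (≟-true⁻ z y zy) xz)
  W-prepend (suc k) x z y xz h with W-suc⁻ k z y h
  ... | inj₁ short = W-suc (suc k) x y (W-prepend k x z y xz short)
  ... | inj₂ (w , w∈ , zw , wy) = W-step (suc k) x y w∈ (W-prepend k x z w xz zw) wy

  W-sym : ∀ k x y → W k x y ≡ true → W k y x ≡ true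
  W-sym zero    x y h = subst (λ t → W 0 t x ≡ true) (≟-true⁻ x y h) (≟-refl x)
  W-sym (suc k) x y h with W-suc⁻ k x y h
  ... | inj₁ short = W-suc k y x (W-sym k x y short)
  ... | inj₂ (z , _ , xz , zy) = W-prepend k y z x (trans (sym-a y z) zy) (W-sym k x z xz)

  d-sym : ∀ x y → d x y ≡ d y x
  d-sym x y = ≤-antisym (d-least (d y x) x y (W-sym (d y x) y x (d-realised y x)))
                        (d-least (d x y) y x (W-sym (d x y) x y (d-realised x y)))

-- `x ≠ᵇ u` is the test by which `splice` deletes u₂ from the vertices of G₂.
_≠ᵇ_ : ∀ {n} → Fin n → Fin n → Bool
x ≠ᵇ u = not (does (x ≟F u))

≠ᵇ-true⁺ : ∀ {n} {x u : Fin n} → x ≢ u → x ≠ᵇ u ≡ true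
≠ᵇ-true⁺ {x = x} {u} x≢u with x ≟F u
... | yes x≡u = ⊥-elim (x≢u x≡u)
... | no _    = refl

≠ᵇ-true⁻ : ∀ {n} {x u : Fin n} → x ≠ᵇ u ≡ true → x ≢ u
≠ᵇ-true⁻ {x = x} {u} h x≡u with x ≟F u
... | yes _   = true≢false (sym h)
... | no x≢u  = x≢u x≡u

delete-here : ∀ {n} (u : Fin n) xs → All (u ≢_) xs → bfilter (_≠ᵇ u) (u ∷ xs) ≡ xs
delete-here u xs u∉xs with u ≟F u
... | yes _   = bfilter-all (_≠ᵇ u) xs (λ x x∈ → ≠ᵇ-true⁺ (λ x≡u → All.lookup u∉xs x∈ (sym x≡u)))
... | no u≢u  = ⊥-elim (u≢u refl)

delete-there : ∀ {n} {u x : Fin n} xs → x ≢ u → bfilter (_≠ᵇ u) (x ∷ xs) ≡ x ∷ bfilter (_≠ᵇ u) xs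
delete-there xs x≢u rewrite ≠ᵇ-true⁺ x≢u = refl

length-delete : ∀ {n} (u : Fin n) {xs} → Unique xs → u ∈ xs → length xs ≡ suc (length (bfilter (_≠ᵇ u) xs))
length-delete u {.u ∷ xs} (u∉xs ∷ _) (here refl) rewrite delete-here u xs u∉xs = refl
length-delete u {x ∷ xs} (x∉xs ∷ uniq) (there u∈xs) rewrite delete-there xs (All.lookup x∉xs u∈xs) =
  cong suc (length-delete u uniq u∈xs)

sumOf : ∀ {A : Set} → (A → ℕ) → List A → ℕ
sumOf f xs = sum (map f xs)

sumOf-++ : ∀ {A : Set} (f : A → ℕ) xs ys → sumOf f (xs ++ ys) ≡ sumOf f xs + sumOf f ys
sumOf-++ f xs ys = trans (cong sum (map-++ f xs ys)) (sum-++ (map f xs) (map f ys))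

sumOf-map : ∀ {A B : Set} (f : B → ℕ) (g : A → B) xs → sumOf f (map g xs) ≡ sumOf (λ x → f (g x)) xs
sumOf-map f g xs = cong sum (sym (map-∘ xs))

sumOf-cong : ∀ {A : Set} {f g : A → ℕ} xs → (∀ x → x ∈ xs → f x ≡ g x) → sumOf f xs ≡ sumOf g xs
sumOf-cong []       _   = refl
sumOf-cong (x ∷ xs) f≗g = cong₂ _+_ (f≗g x (here refl)) (sumOf-cong xs (λ y y∈ → f≗g y (there y∈)))

sumOf-const : ∀ {A : Set} c (xs : List A) → sumOf (λ _ → c) xs ≡ length xs * c
sumOf-const c []       = refl
sumOf-const c (_ ∷ xs) = cong (c +_) (sumOf-const c xs)

sumOf-zero : ∀ {A : Set} (f : A → ℕ) xs → (∀ x → x ∈ xs → f x ≡ 0) → sumOf f xs ≡ 0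
sumOf-zero f xs f≗0 = trans (sumOf-cong xs f≗0) (trans (sumOf-const 0 xs) (*-zeroʳ (length xs)))

sumOf-+ : ∀ {A : Set} (f g : A → ℕ) xs → sumOf (λ x → f x + g x) xs ≡ sumOf f xs + sumOf g xs
sumOf-+ f g []       = refl
sumOf-+ f g (x ∷ xs) = trans (cong (f x + g x +_) (sumOf-+ f g xs)) (interchange (f x) (g x) (sumOf f xs) (sumOf g xs))

sumOf-* : ∀ {A : Set} c (f : A → ℕ) xs → sumOf (λ x → c * f x) xs ≡ c * sumOf f xs
sumOf-* c f []       = sym (*-zeroʳ c)
sumOf-* c f (x ∷ xs) = trans (cong (c * f x +_) (sumOf-* c f xs)) (sym (*-distribˡ-+ c (f x) (sumOf f xs)))

sumOf-bfilter : ∀ {A : Set} (p : A → Bool) (f : A → ℕ) xs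
              → sumOf f (bfilter p xs) ≡ sumOf (λ x → if p x then f x else 0) xs
sumOf-bfilter p f [] = refl
sumOf-bfilter p f (x ∷ xs) with p x
... | true  = cong (f x +_) (sumOf-bfilter p f xs)
... | false = sumOf-bfilter p f xs

⟦_⟧ : Bool → ℕ
⟦ b ⟧ = if b then 1 else 0

length-bfilter : ∀ {A : Set} (p : A → Bool) xs → length (bfilter p xs) ≡ sumOf (λ x → ⟦ p x ⟧) xs
length-bfilter p [] = refl
length-bfilter p (x ∷ xs) with p x
... | true  = cong suc (length-bfilter p xs)
... | false = length-bfilter p xs

sumOf-delete : ∀ {n} (u : Fin n) (g : Fin n → ℕ) {xs} → Unique xs → u ∈ xs
             → sumOf g xs ≡ sumOf g (bfilter (_≠ᵇ u) xs) + g u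
sumOf-delete u g {.u ∷ xs} (u∉xs ∷ _) (here refl) rewrite delete-here u xs u∉xs = +-comm (g u) _
sumOf-delete u g {x ∷ xs} (x∉xs ∷ uniq) (there u∈xs) rewrite delete-there xs (All.lookup x∉xs u∈xs) =
  trans (cong (g x +_) (sumOf-delete u g uniq u∈xs)) (sym (+-assoc (g x) _ _))

module EdgeSums (G : Graph) (F : Graph.V G × Graph.V G → ℕ) where
  open Graph G

  edgeSum : List V → ℕ
  edgeSum xs = sumOf F (edgesFrom G xs)

  weight : V → V → ℕ
  weight x y = if adj x y then F (x , y) else 0

  star : V → List V → ℕ
  star x ys = sumOf (weight x) ys

  cross : List V → List V → ℕ
  cross xs ys = sumOf (λ x → star x ys) xs

  edgeSum-∷ : ∀ x xs → edgeSum (x ∷ xs) ≡ star x xs + edgeSum xs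
  edgeSum-∷ x xs = begin
    sumOf F (map (x ,_) (bfilter (adj x) xs) ++ edgesFrom G xs)
      ≡⟨ sumOf-++ F (map (x ,_) (bfilter (adj x) xs)) _ ⟩
    sumOf F (map (x ,_) (bfilter (adj x) xs)) + edgeSum xs
      ≡⟨ cong (_+ edgeSum xs) (trans (sumOf-map F (x ,_) (bfilter (adj x) xs))
                                     (sumOf-bfilter (adj x) (λ y → F (x , y)) xs)) ⟩
    star x xs + edgeSum xs ∎
    where open ≡-Reasoning

  edgeSum-++ : ∀ xs ys → edgeSum (xs ++ ys) ≡ edgeSum xs + edgeSum ys + cross xs ys
  edgeSum-++ []       ys = sym (+-identityʳ _)
  edgeSum-++ (x ∷ xs) ys = begin
    edgeSum (x ∷ xs ++ ys)                                  ≡⟨ edgeSum-∷ x (xs ++ ys) ⟩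
    star x (xs ++ ys) + edgeSum (xs ++ ys)                  ≡⟨ cong₂ _+_ (sumOf-++ (weight x) xs ys) (edgeSum-++ xs ys) ⟩
    (star x xs + star x ys) + (edgeSum xs + edgeSum ys + cross xs ys)
      ≡⟨ shuffle (star x xs) (star x ys) (edgeSum xs) (edgeSum ys) (cross xs ys) ⟩
    (star x xs + edgeSum xs) + edgeSum ys + (star x ys + cross xs ys)
      ≡⟨ cong (λ t → t + edgeSum ys + cross (x ∷ xs) ys) (sym (edgeSum-∷ x xs)) ⟩
    edgeSum (x ∷ xs) + edgeSum ys + cross (x ∷ xs) ys       ∎
    where
    open ≡-Reasoning
    shuffle : ∀ (a b c d e : ℕ) → (a + b) + (c + d + e) ≡ (a + c) + d + (b + e)
    shuffle = solve-∀

edgeSum-cong : ∀ (G : Graph) (F F′ : Graph.V G × Graph.V G → ℕ) xs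
             → (∀ x y → x ∈ xs → y ∈ xs → F (x , y) ≡ F′ (x , y))
             → EdgeSums.edgeSum G F xs ≡ EdgeSums.edgeSum G F′ xs
edgeSum-cong G F F′ []       _    = refl
edgeSum-cong G F F′ (x ∷ xs) F≗F′ = begin
  edgeSum F (x ∷ xs)          ≡⟨ edgeSum-∷ F x xs ⟩
  star F x xs + edgeSum F xs  ≡⟨ cong₂ _+_ (sumOf-cong xs weight≗) (edgeSum-cong G F F′ xs (λ a b a∈ b∈ → F≗F′ a b (there a∈) (there b∈))) ⟩
  star F′ x xs + edgeSum F′ xs ≡⟨ sym (edgeSum-∷ F′ x xs) ⟩
  edgeSum F′ (x ∷ xs)         ∎
  where
  open ≡-Reasoning
  open EdgeSums G
  weight≗ : ∀ y → y ∈ xs → weight F x y ≡ weight F′ x y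
  weight≗ y y∈ with Graph.adj G x y
  ... | true  = F≗F′ x y (here refl) (there y∈)
  ... | false = refl

edgeSum-delete : ∀ n (a : Fin n → Fin n → Bool) → Symmetric a
               → (F : Fin n × Fin n → ℕ) → (∀ x y → F (x , y) ≡ F (y , x))
               → (u : Fin n) → ∀ {xs} → Unique xs → u ∈ xs
               → EdgeSums.edgeSum (FinGraph n a) F xs
                 ≡ EdgeSums.edgeSum (FinGraph n a) F (bfilter (_≠ᵇ u) xs) + EdgeSums.star (FinGraph n a) F u (bfilter (_≠ᵇ u) xs)
edgeSum-delete n a sym-a F sym-F u {.u ∷ xs} (u∉xs ∷ _) (here refl) rewrite delete-here u xs u∉xs =
  trans (EdgeSums.edgeSum-∷ (FinGraph n a) F u xs) (+-comm (EdgeSums.star (FinGraph n a) F u xs) _)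
edgeSum-delete n a sym-a F sym-F u {x ∷ xs} (x∉xs ∷ uniq) (there u∈xs) rewrite delete-there xs (All.lookup x∉xs u∈xs) = begin
  edgeSum (x ∷ xs)                                          ≡⟨ edgeSum-∷ x xs ⟩
  star x xs + edgeSum xs                                    ≡⟨ cong₂ _+_ (sumOf-delete u (weight x) uniq u∈xs)
                                                                         (edgeSum-delete n a sym-a F sym-F u uniq u∈xs) ⟩
  (star x xs′ + weight x u) + (edgeSum xs′ + star u xs′)    ≡⟨ cong (λ t → (star x xs′ + t) + (edgeSum xs′ + star u xs′)) weight-sym ⟩
  (star x xs′ + weight u x) + (edgeSum xs′ + star u xs′)    ≡⟨ interchange (star x xs′) (weight u x) (edgeSum xs′) (star u xs′) ⟩
  (star x xs′ + edgeSum xs′) + (weight u x + star u xs′)    ≡⟨ cong (_+ star u (x ∷ xs′)) (sym (edgeSum-∷ x xs′)) ⟩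
  edgeSum (x ∷ xs′) + star u (x ∷ xs′)                      ∎
  where
  open ≡-Reasoning
  open EdgeSums (FinGraph n a) F
  xs′ : List (Fin n)
  xs′ = bfilter (_≠ᵇ u) xs
  weight-sym : weight x u ≡ weight u x
  weight-sym rewrite sym-a x u | sym-F x u = refl

szegedTerm : (G : Graph) → Graph.V G × Graph.V G → ℕ
szegedTerm G (u , v) = mcount G u v * mcount G v u

Sze-sum : ∀ G → Sze G ≡ sumOf (szegedTerm G) (edges G)
Sze-sum G = sumOf-cong (edges G) (λ { (u , v) _ → refl })

-- If each of m_u(e), m_v(e) grows by E for exactly the endpoint strictly
-- closer to the root (p, q being the endpoints' root distances), the
-- product grows by E times the m-value of the endpoint farther away.
shifted-product : ∀ A B E p q → (A + E * ⟦ p <ᵇ q ⟧) * (B + E * ⟦ q <ᵇ p ⟧)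
                ≡ A * B + E * (if q <ᵇ p then A else (if p <ᵇ q then B else 0))
shifted-product A B E p q with q <ᵇ p in q<p | p <ᵇ q in p<q
... | true  | true  = ⊥-elim (<-asym (<ᵇ⇒< q p (subst T (sym q<p) tt)) (<ᵇ⇒< p q (subst T (sym p<q) tt)))
... | true  | false = grow-B A B E
  where
  grow-B : ∀ (A B E : ℕ) → (A + E * 0) * (B + E * 1) ≡ A * B + E * A
  grow-B = solve-∀
... | false | true  = grow-A A B E
  where
  grow-A : ∀ (A B E : ℕ) → (A + E * 1) * (B + E * 0) ≡ A * B + E * B
  grow-A = solve-∀
... | false | false = unchanged A B E
  where
  unchanged : ∀ (A B E : ℕ) → (A + E * 0) * (B + E * 0) ≡ A * B + E * 0
  unchanged = solve-∀

module Splice (n₁ n₂ : ℕ) (a₁ : Fin n₁ → Fin n₁ → Bool) (a₂ : Fin n₂ → Fin n₂ → Bool)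
              (u₁ : Fin n₁) (u₂ : Fin n₂) where

  S : Graph
  S = splice n₁ n₂ a₁ a₂ u₁ u₂

  Vert : Set
  Vert = Fin n₁ ⊎ Fin n₂

  V₂° : List (Fin n₂)
  V₂° = bfilter (_≠ᵇ u₂) (allFin n₂)

  IsVertex : Vert → Set
  IsVertex (inj₁ _) = ⊤
  IsVertex (inj₂ y) = y ≢ u₂

  vertex⇒∈ : ∀ v → IsVertex v → v ∈ Graph.verts S
  vertex⇒∈ (inj₁ x) _   = ∈-++⁺ˡ (∈-map⁺ inj₁ (∈-allFin x))
  vertex⇒∈ (inj₂ y) y≢u = ∈-++⁺ʳ (map inj₁ (allFin n₁)) (∈-map⁺ inj₂ (bfilter-∈⁺ (_≠ᵇ u₂) (allFin n₂) (∈-allFin y) (≠ᵇ-true⁺ y≢u)))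

  ∈⇒vertex : ∀ v → v ∈ Graph.verts S → IsVertex v
  ∈⇒vertex (inj₁ x) _ = tt
  ∈⇒vertex (inj₂ y) v∈ with ∈-++⁻ (map inj₁ (allFin n₁)) v∈
  ... | inj₁ v∈₁ with ∈-map⁻ inj₁ v∈₁
  ... | _ , _ , ()
  ∈⇒vertex (inj₂ y) v∈ | inj₂ v∈₂ with ∈-map⁻ inj₂ v∈₂
  ... | z , z∈ , refl = ≠ᵇ-true⁻ (proj₂ (bfilter-∈⁻ (_≠ᵇ u₂) (allFin n₂) z∈))

  π₁ : Vert → Fin n₁
  π₁ (inj₁ x) = x
  π₁ (inj₂ _) = u₁

  π₂ : Vert → Fin n₂
  π₂ (inj₁ _) = u₂
  π₂ (inj₂ y) = y

  adj-split : ∀ z y → Graph.adj S z y ≡ true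
            → (π₂ z ≡ π₂ y × a₁ (π₁ z) (π₁ y) ≡ true) ⊎ (π₁ z ≡ π₁ y × a₂ (π₂ z) (π₂ y) ≡ true)
  adj-split (inj₁ z) (inj₁ y) zy = inj₁ (refl , zy)
  adj-split (inj₂ z) (inj₂ y) zy = inj₂ (refl , zy)
  adj-split (inj₁ z) (inj₂ y) zy with ∧-true⁻ (does (z ≟F u₁)) (a₂ u₂ y) zy
  ... | z≡u , uy = inj₂ (≟-true⁻ z u₁ z≡u , uy)
  adj-split (inj₂ z) (inj₁ y) zy with ∧-true⁻ (a₂ z u₂) (does (y ≟F u₁)) zy
  ... | zu , y≡u = inj₂ (sym (≟-true⁻ y u₁ y≡u) , zu)

  |V₂|≡1+|V₂°| : length (allFin n₂) ≡ suc (length V₂°)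
  |V₂|≡1+|V₂°| = length-delete u₂ (allFin⁺ n₂) (∈-allFin u₂)

  |V_S| : length (Graph.verts S) ≡ length (allFin n₁) + length V₂°
  |V_S| = trans (length-++ (map inj₁ (allFin n₁)))
                (cong₂ _+_ (length-map inj₁ (allFin n₁)) (length-map inj₂ V₂°))

  G₁ G₂ : Graph
  G₁ = FinGraph n₁ a₁
  G₂ = FinGraph n₂ a₂

  ι : Fin n₂ → Vert
  ι y = if does (y ≟F u₂) then inj₁ u₁ else inj₂ y

  ι-cut : ι u₂ ≡ inj₁ u₁
  ι-cut rewrite ≟-refl u₂ = refl

  ι-other : ∀ {y} → y ≢ u₂ → ι y ≡ inj₂ y
  ι-other {y} y≢u with y ≟F u₂
  ... | yes y≡u = ⊥-elim (y≢u y≡u)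
  ... | no _    = refl

  φ₁ : Fin n₁ × Fin n₁ → Vert × Vert
  φ₁ (x , y) = inj₁ x , inj₁ y

  φ₂ : Fin n₂ × Fin n₂ → Vert × Vert
  φ₂ (x , y) = ι x , ι y

  inj₂² : Fin n₂ × Fin n₂ → Vert × Vert
  inj₂² (x , y) = inj₂ x , inj₂ y

  module _ (F : Vert × Vert → ℕ) where
    open EdgeSums S F using () renaming (edgeSum to edgeSumS; star to starS; cross to crossS)
    private
      module E₁  = EdgeSums G₁ (λ e → F (φ₁ e))
      module E₂  = EdgeSums G₂ (λ e → F (φ₂ e))
      module E₂° = EdgeSums G₂ (λ e → F (inj₂² e))

    cutStar : ℕ
    cutStar = starS (inj₁ u₁) (map inj₂ V₂°)

    edgeSum-inj₁ : ∀ xs → edgeSumS (map inj₁ xs) ≡ E₁.edgeSum xs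
    edgeSum-inj₁ []       = refl
    edgeSum-inj₁ (x ∷ xs) = trans (EdgeSums.edgeSum-∷ S F (inj₁ x) (map inj₁ xs))
      (trans (cong₂ _+_ (sumOf-map (EdgeSums.weight S F (inj₁ x)) inj₁ xs) (edgeSum-inj₁ xs)) (sym (E₁.edgeSum-∷ x xs)))

    edgeSum-inj₂ : ∀ ys → edgeSumS (map inj₂ ys) ≡ E₂°.edgeSum ys
    edgeSum-inj₂ []       = refl
    edgeSum-inj₂ (y ∷ ys) = trans (EdgeSums.edgeSum-∷ S F (inj₂ y) (map inj₂ ys))
      (trans (cong₂ _+_ (sumOf-map (EdgeSums.weight S F (inj₂ y)) inj₂ ys) (edgeSum-inj₂ ys)) (sym (E₂°.edgeSum-∷ y ys)))

    cross-blocks : crossS (map inj₁ (allFin n₁)) (map inj₂ V₂°) ≡ cutStar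
    cross-blocks = begin
      crossS (map inj₁ (allFin n₁)) (map inj₂ V₂°)            ≡⟨ sumOf-map (λ v → starS v (map inj₂ V₂°)) inj₁ (allFin n₁) ⟩
      sumOf starFrom (allFin n₁)                              ≡⟨ sumOf-delete u₁ starFrom (allFin⁺ n₁) (∈-allFin u₁) ⟩
      sumOf starFrom (bfilter (_≠ᵇ u₁) (allFin n₁)) + cutStar ≡⟨ cong (_+ cutStar) (sumOf-zero starFrom _ off-cut) ⟩
      cutStar                                                 ∎
      where
      open ≡-Reasoning
      starFrom : Fin n₁ → ℕ
      starFrom x = starS (inj₁ x) (map inj₂ V₂°)
      off-cut : ∀ x → x ∈ bfilter (_≠ᵇ u₁) (allFin n₁) → starFrom x ≡ 0
      off-cut x x∈ = trans (sumOf-map (EdgeSums.weight S F (inj₁ x)) inj₂ V₂°) (sumOf-zero _ V₂° (λ y _ → no-edge y))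
        where
        x≢u : does (x ≟F u₁) ≡ false
        x≢u with x ≟F u₁
        ... | yes x≡u = ⊥-elim (≠ᵇ-true⁻ (proj₂ (bfilter-∈⁻ (_≠ᵇ u₁) (allFin n₁) x∈)) x≡u)
        ... | no _    = refl
        no-edge : ∀ y → EdgeSums.weight S F (inj₁ x) (inj₂ y) ≡ 0
        no-edge y rewrite x≢u = refl

    -- Deleting u₂ from G₂ removes the star of u₂, which in S is the cut star.
    edgeSum-G₂ : (∀ v w → F (v , w) ≡ F (w , v)) → Symmetric a₂
               → E₂.edgeSum (allFin n₂) ≡ E₂°.edgeSum V₂° + cutStar
    edgeSum-G₂ sym-F sym₂ = begin
      E₂.edgeSum (allFin n₂)                    ≡⟨ edgeSum-delete n₂ a₂ sym₂ (λ e → F (φ₂ e)) (λ x y → sym-F (ι x) (ι y))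
                                                                  u₂ (allFin⁺ n₂) (∈-allFin u₂) ⟩
      E₂.edgeSum V₂° + E₂.star u₂ V₂°           ≡⟨ cong₂ _+_ (edgeSum-cong G₂ _ _ V₂° (λ x y x∈ y∈ →
                                                     cong₂ (λ v w → F (v , w)) (ι-other (in-V₂° x∈)) (ι-other (in-V₂° y∈))))
                                                   (trans (sumOf-cong V₂° (λ y y∈ → at-cut y (in-V₂° y∈)))
                                                          (sym (sumOf-map (EdgeSums.weight S F (inj₁ u₁)) inj₂ V₂°))) ⟩
      E₂°.edgeSum V₂° + cutStar                 ∎
      where
      open ≡-Reasoning
      in-V₂° : ∀ {y} → y ∈ V₂° → y ≢ u₂
      in-V₂° y∈ = ≠ᵇ-true⁻ (proj₂ (bfilter-∈⁻ (_≠ᵇ u₂) (allFin n₂) y∈))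
      at-cut : ∀ y → y ≢ u₂ → E₂.weight u₂ y ≡ EdgeSums.weight S F (inj₁ u₁) (inj₂ y)
      at-cut y y≢u rewrite ι-cut | ι-other y≢u | ≟-refl u₁ = refl

    edgeSum-splice : (∀ v w → F (v , w) ≡ F (w , v)) → Symmetric a₂
                   → sumOf F (edges S) ≡ sumOf (λ e → F (φ₁ e)) (edges G₁) + sumOf (λ e → F (φ₂ e)) (edges G₂)
    edgeSum-splice sym-F sym₂ = begin
      edgeSumS (map inj₁ (allFin n₁) ++ map inj₂ V₂°)
        ≡⟨ EdgeSums.edgeSum-++ S F (map inj₁ (allFin n₁)) (map inj₂ V₂°) ⟩
      edgeSumS (map inj₁ (allFin n₁)) + edgeSumS (map inj₂ V₂°) + crossS (map inj₁ (allFin n₁)) (map inj₂ V₂°)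
        ≡⟨ cong₂ _+_ (cong₂ _+_ (edgeSum-inj₁ (allFin n₁)) (edgeSum-inj₂ V₂°)) cross-blocks ⟩
      E₁.edgeSum (allFin n₁) + E₂°.edgeSum V₂° + cutStar
        ≡⟨ +-assoc (E₁.edgeSum (allFin n₁)) _ _ ⟩
      E₁.edgeSum (allFin n₁) + (E₂°.edgeSum V₂° + cutStar)
        ≡⟨ cong (E₁.edgeSum (allFin n₁) +_) (sym (edgeSum-G₂ sym-F sym₂)) ⟩
      E₁.edgeSum (allFin n₁) + E₂.edgeSum (allFin n₂) ∎
      where open ≡-Reasoning

-- This is proved by checking
-- that the right-hand side is a breadth-first labelling.
module SpliceDistance (n₁ n₂ : ℕ) (a₁ : Fin n₁ → Fin n₁ → Bool) (a₂ : Fin n₂ → Fin n₂ → Bool)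
    (sym₁ : Symmetric a₁) (conn₁ : Connected (FinGraph n₁ a₁))
    (sym₂ : Symmetric a₂) (conn₂ : Connected (FinGraph n₂ a₂))
    (u₁ : Fin n₁) (u₂ : Fin n₂) where

  open Splice n₁ n₂ a₁ a₂ u₁ u₂ public
  module M₁ = Metric n₁ a₁ sym₁ conn₁ u₁
  module M₂ = Metric n₂ a₂ sym₂ conn₂ u₂
  open M₁ using () renaming (d to d₁)
  open M₂ using () renaming (d to d₂)

  δ : Vert → Vert → ℕ
  δ v w = d₁ (π₁ v) (π₁ w) + d₂ (π₂ v) (π₂ w)

  open Graph S using (verts; eq?; adj)

  δ-zero-at-source : ∀ v y → y ∈ verts → eq? v y ≡ true → δ v y ≡ 0
  δ-zero-at-source (inj₁ x) (inj₁ y) _ x≡y rewrite ≟-true⁻ x y x≡y = cong₂ _+_ (M₁.d-refl y) (M₂.d-refl u₂)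
  δ-zero-at-source (inj₂ x) (inj₂ y) _ x≡y rewrite ≟-true⁻ x y x≡y = cong₂ _+_ (M₁.d-refl u₁) (M₂.d-refl y)

  δ-source-at-zero : ∀ v → IsVertex v → ∀ y → y ∈ verts → δ v y ≡ 0 → eq? v y ≡ true
  δ-source-at-zero v v-vertex y y∈ δ≡0 with ∈⇒vertex y y∈
                                           | M₁.d≡0⇒≡ _ _ (m+n≡0⇒m≡0 _ δ≡0) | M₂.d≡0⇒≡ _ _ (m+n≡0⇒n≡0 _ δ≡0)
  δ-source-at-zero (inj₁ x) _   (inj₁ y) _ _ | _   | x≡y | _   = subst (λ t → does (x ≟F t) ≡ true) x≡y (≟-refl x)
  δ-source-at-zero (inj₂ x) x≢u (inj₁ y) _ _ | _   | _   | x≡u = ⊥-elim (x≢u x≡u)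
  δ-source-at-zero (inj₁ x) _   (inj₂ y) _ _ | y≢u | _   | u≡y = ⊥-elim (y≢u (sym u≡y))
  δ-source-at-zero (inj₂ x) _   (inj₂ y) _ _ | _   | _   | x≡y = subst (λ t → does (x ≟F t) ≡ true) x≡y (≟-refl x)

  δ-edge-step : ∀ v z y → adj z y ≡ true → δ v y ≤ suc (δ v z)
  δ-edge-step v z y zy with adj-split z y zy
  ... | inj₁ (π₂z≡π₂y , zy₁) rewrite π₂z≡π₂y =
        +-monoˡ-≤ (d₂ (π₂ v) (π₂ y)) (M₁.d-edge (π₁ v) (π₁ z) (π₁ y) zy₁)
  ... | inj₂ (π₁z≡π₁y , zy₂) rewrite π₁z≡π₁y =
        ≤-trans (+-monoʳ-≤ (d₁ (π₁ v) (π₁ y)) (M₂.d-edge (π₂ v) (π₂ z) (π₂ y) zy₂)) (≤-reflexive (+-suc _ _))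

  private
    peel-suc : ∀ c j k → c + suc j ≡ suc k → c + j ≡ k
    peel-suc c j k h = suc-injective (trans (sym (+-suc c j)) h)

  -- A predecessor of a G₁-vertex comes from G₁, unless the vertex is the
  -- first shadow of v itself; then it is reached through G₂ and the cut.
  δ-predecessor₁ : ∀ v y k → δ v (inj₁ y) ≡ suc k
                 → ∃ λ z → z ∈ verts × adj z (inj₁ y) ≡ true × δ v z ≡ k
  δ-predecessor₁ v y k δ≡k+1 with d₁ (π₁ v) y in d≡
  δ-predecessor₁ v y k δ≡k+1 | suc j with M₁.d-predecessor (π₁ v) y j d≡
  ... | z , zy , dz≡j =
        inj₁ z , vertex⇒∈ (inj₁ z) tt , zy , trans (cong (_+ d₂ (π₂ v) u₂) dz≡j) (suc-injective δ≡k+1)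
  δ-predecessor₁ (inj₁ x) y k δ≡k+1 | zero = ⊥-elim (0≢1+n (trans (sym (M₂.d-refl u₂)) δ≡k+1))
  δ-predecessor₁ (inj₂ x) y k δ≡k+1 | zero with M₂.d-predecessor x u₂ k δ≡k+1
  ... | z , zu , dz≡k =
        inj₂ z , vertex⇒∈ (inj₂ z) z≢u , ∧-true⁺ zu cut , trans (cong (_+ d₂ x z) (M₁.d-refl u₁)) dz≡k
    where
    z≢u : z ≢ u₂
    z≢u refl = 1+n≢n (trans (sym δ≡k+1) dz≡k)
    cut : does (y ≟F u₁) ≡ true
    cut = subst (λ t → does (t ≟F u₁) ≡ true) (M₁.d≡0⇒≡ u₁ y d≡) (≟-refl u₁)

  -- Symmetrically for a vertex of G₂ other than u₂; a predecessor u₂ in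
  -- G₂ is represented by the cut vertex inj₁ u₁.
  δ-predecessor₂ : ∀ v y k → y ≢ u₂ → δ v (inj₂ y) ≡ suc k
                 → ∃ λ z → z ∈ verts × adj z (inj₂ y) ≡ true × δ v z ≡ k
  δ-predecessor₂ v y k y≢u δ≡k+1 with d₂ (π₂ v) y in d≡
  δ-predecessor₂ v y k y≢u δ≡k+1 | suc j with M₂.d-predecessor (π₂ v) y j d≡
  ... | z , zy , dz≡j with z ≟F u₂
  ... | yes refl = inj₁ u₁ , vertex⇒∈ (inj₁ u₁) tt , ∧-true⁺ (≟-refl u₁) zy ,
                   trans (cong (d₁ (π₁ v) u₁ +_) dz≡j) (peel-suc _ j k δ≡k+1)
  ... | no z≢u   = inj₂ z , vertex⇒∈ (inj₂ z) z≢u , zy ,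
                   trans (cong (d₁ (π₁ v) u₁ +_) dz≡j) (peel-suc _ j k δ≡k+1)
  δ-predecessor₂ (inj₁ x) y k y≢u δ≡k+1 | zero = ⊥-elim (y≢u (sym (M₂.d≡0⇒≡ u₂ y d≡)))
  δ-predecessor₂ (inj₂ x) y k y≢u δ≡k+1 | zero =
    ⊥-elim (0≢1+n (trans (sym (trans (+-identityʳ (d₁ u₁ u₁)) (M₁.d-refl u₁))) δ≡k+1))

  δ-bounded : ∀ v y → δ v y ≤ length verts
  δ-bounded v y = begin
    d₁ (π₁ v) (π₁ y) + d₂ (π₂ v) (π₂ y) ≤⟨ +-mono-≤ (M₁.d-bound _ _) (M₂.d-bound _ _) ⟩
    pred n₁ + pred n₂                   ≤⟨ +-mono-≤ pred-n₁≤ (≤-reflexive pred-n₂≡) ⟩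
    length (allFin n₁) + length V₂°     ≡⟨ sym |V_S| ⟩
    length verts                        ∎
    where
    open ≤-Reasoning
    pred-n₁≤ : pred n₁ ≤ length (allFin n₁)
    pred-n₁≤ = ≤-trans (n≤1+n _) (≤-reflexive (sym M₁.|V|≡1+pred-n))
    pred-n₂≡ : pred n₂ ≡ length V₂°
    pred-n₂≡ = suc-injective (trans (sym M₂.|V|≡1+pred-n) |V₂|≡1+|V₂°|)

  δ-labelling : ∀ v → IsVertex v → Walks.Labelling S v (δ v)
  δ-labelling v v-vertex = record
    { zero-at-source = δ-zero-at-source v
    ; source-at-zero = δ-source-at-zero v v-vertex
    ; edge-step      = λ z y _ _ → δ-edge-step v z y
    ; predecessor    = predecessor
    ; bounded        = λ y _ → δ-bounded v y
    }
    where
    predecessor : ∀ y k → y ∈ verts → δ v y ≡ suc k → ∃ λ z → z ∈ verts × adj z y ≡ true × δ v z ≡ k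
    predecessor (inj₁ y) k _  = δ-predecessor₁ v y k
    predecessor (inj₂ y) k y∈ = δ-predecessor₂ v y k (∈⇒vertex (inj₂ y) y∈)

  dist-splice : ∀ v w → IsVertex v → IsVertex w → dist S v w ≡ δ v w
  dist-splice v w v-vertex w-vertex = Walks.labelling-dist S (δ-labelling v v-vertex) w (vertex⇒∈ w w-vertex)

  π-ι : ∀ y → π₁ (ι y) ≡ u₁ × π₂ (ι y) ≡ y × IsVertex (ι y)
  π-ι y with y ≟F u₂
  ... | yes y≡u = refl , sym y≡u , tt
  ... | no y≢u  = refl , refl , y≢u

  distE-φ₁ : ∀ x y w → IsVertex w → distE S (φ₁ (x , y)) w ≡ distE G₁ (x , y) (π₁ w) + d₂ u₂ (π₂ w)
  distE-φ₁ x y w w-vertex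
    rewrite dist-splice (inj₁ x) w tt w-vertex | dist-splice (inj₁ y) w tt w-vertex =
    sym (+-distribʳ-⊓ (d₂ u₂ (π₂ w)) (d₁ x (π₁ w)) (d₁ y (π₁ w)))

  dist-ι : ∀ x w → IsVertex w → dist S (ι x) w ≡ d₁ u₁ (π₁ w) + d₂ x (π₂ w)
  dist-ι x w w-vertex with π-ι x
  ... | π₁≡u , π₂≡x , ιx-vertex =
    trans (dist-splice (ι x) w ιx-vertex w-vertex)
          (cong₂ _+_ (cong (λ t → d₁ t (π₁ w)) π₁≡u) (cong (λ t → d₂ t (π₂ w)) π₂≡x))

  distE-φ₂ : ∀ x y w → IsVertex w → distE S (φ₂ (x , y)) w ≡ d₁ u₁ (π₁ w) + distE G₂ (x , y) (π₂ w)
  distE-φ₂ x y w w-vertex rewrite dist-ι x w w-vertex | dist-ι y w w-vertex =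
    sym (+-distribˡ-⊓ (d₁ u₁ (π₁ w)) (d₂ x (π₂ w)) (d₂ y (π₂ w)))

  mcount-splice : ∀ v w → mcount S v w
    ≡ sumOf (λ e → ⟦ distE S (φ₁ e) v <ᵇ distE S (φ₁ e) w ⟧) (edges G₁)
    + sumOf (λ e → ⟦ distE S (φ₂ e) v <ᵇ distE S (φ₂ e) w ⟧) (edges G₂)
  mcount-splice v w = trans (length-bfilter _ (edges S)) (edgeSum-splice closer closer-sym sym₂)
    where
    closer : Vert × Vert → ℕ
    closer g = ⟦ distE S g v <ᵇ distE S g w ⟧
    closer-sym : ∀ x y → closer (x , y) ≡ closer (y , x)
    closer-sym x y rewrite ⊓-comm (dist S x v) (dist S y v) | ⊓-comm (dist S x w) (dist S y w) = refl

  private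
    <ᵇ-cancelˡ : ∀ c p q → (c + p <ᵇ c + q) ≡ (p <ᵇ q)
    <ᵇ-cancelˡ zero    p q = refl
    <ᵇ-cancelˡ (suc c) p q = <ᵇ-cancelˡ c p q

    <ᵇ-cancelʳ : ∀ c p q → (p + c <ᵇ q + c) ≡ (p <ᵇ q)
    <ᵇ-cancelʳ c p q rewrite +-comm p c | +-comm q c = <ᵇ-cancelˡ c p q

  -- For two vertices on the G₁ side, an edge of G₂ is closer to v exactly
  -- when v is closer to the cut vertex; so it contributes |E₂| or nothing.
  mcount-G₁-side : ∀ v w → IsVertex v → IsVertex w → π₂ v ≡ u₂ → π₂ w ≡ u₂
    → mcount S v w ≡ mcount G₁ (π₁ v) (π₁ w) + length (edges G₂) * ⟦ d₁ (π₁ v) u₁ <ᵇ d₁ (π₁ w) u₁ ⟧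
  mcount-G₁-side v w v-vertex w-vertex π₂v≡u π₂w≡u =
    trans (mcount-splice v w) (cong₂ _+_ (trans (sumOf-cong (edges G₁) own) (sym (length-bfilter _ (edges G₁))))
                                         (trans (sumOf-cong (edges G₂) other) (sumOf-const _ (edges G₂))))
    where
    own : ∀ e → e ∈ edges G₁ → ⟦ distE S (φ₁ e) v <ᵇ distE S (φ₁ e) w ⟧ ≡ ⟦ distE G₁ e (π₁ v) <ᵇ distE G₁ e (π₁ w) ⟧
    own (x , y) _ rewrite distE-φ₁ x y v v-vertex | distE-φ₁ x y w w-vertex | π₂v≡u | π₂w≡u =
      cong ⟦_⟧ (<ᵇ-cancelʳ (d₂ u₂ u₂) (distE G₁ (x , y) (π₁ v)) (distE G₁ (x , y) (π₁ w)))
    other : ∀ e → e ∈ edges G₂ → ⟦ distE S (φ₂ e) v <ᵇ distE S (φ₂ e) w ⟧ ≡ ⟦ d₁ (π₁ v) u₁ <ᵇ d₁ (π₁ w) u₁ ⟧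
    other (x , y) _ rewrite distE-φ₂ x y v v-vertex | distE-φ₂ x y w w-vertex | π₂v≡u | π₂w≡u
                          | M₁.d-sym u₁ (π₁ v) | M₁.d-sym u₁ (π₁ w) =
      cong ⟦_⟧ (<ᵇ-cancelʳ (distE G₂ (x , y) u₂) (d₁ (π₁ v) u₁) (d₁ (π₁ w) u₁))

  mcount-G₂-side : ∀ v w → IsVertex v → IsVertex w → π₁ v ≡ u₁ → π₁ w ≡ u₁
    → mcount S v w ≡ mcount G₂ (π₂ v) (π₂ w) + length (edges G₁) * ⟦ d₂ (π₂ v) u₂ <ᵇ d₂ (π₂ w) u₂ ⟧
  mcount-G₂-side v w v-vertex w-vertex π₁v≡u π₁w≡u =
    trans (mcount-splice v w) (trans (+-comm (sumOf (λ e → ⟦ distE S (φ₁ e) v <ᵇ distE S (φ₁ e) w ⟧) (edges G₁)) _)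
      (cong₂ _+_ (trans (sumOf-cong (edges G₂) own) (sym (length-bfilter _ (edges G₂))))
                 (trans (sumOf-cong (edges G₁) other) (sumOf-const _ (edges G₁)))))
    where
    own : ∀ e → e ∈ edges G₂ → ⟦ distE S (φ₂ e) v <ᵇ distE S (φ₂ e) w ⟧ ≡ ⟦ distE G₂ e (π₂ v) <ᵇ distE G₂ e (π₂ w) ⟧
    own (x , y) _ rewrite distE-φ₂ x y v v-vertex | distE-φ₂ x y w w-vertex | π₁v≡u | π₁w≡u =
      cong ⟦_⟧ (<ᵇ-cancelˡ (d₁ u₁ u₁) (distE G₂ (x , y) (π₂ v)) (distE G₂ (x , y) (π₂ w)))
    other : ∀ e → e ∈ edges G₁ → ⟦ distE S (φ₁ e) v <ᵇ distE S (φ₁ e) w ⟧ ≡ ⟦ d₂ (π₂ v) u₂ <ᵇ d₂ (π₂ w) u₂ ⟧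
    other (x , y) _ rewrite distE-φ₁ x y v v-vertex | distE-φ₁ x y w w-vertex | π₁v≡u | π₁w≡u
                          | M₂.d-sym u₂ (π₂ v) | M₂.d-sym u₂ (π₂ w) =
      cong ⟦_⟧ (<ᵇ-cancelˡ (distE G₁ (x , y) u₁) (d₂ (π₂ v) u₂) (d₂ (π₂ w) u₂))

  szegedTerm-G₁ : ∀ e → szegedTerm S (φ₁ e) ≡ szegedTerm G₁ e + length (edges G₂) * mroot G₁ u₁ e
  szegedTerm-G₁ (x , y)
    rewrite mcount-G₁-side (inj₁ x) (inj₁ y) tt tt refl refl | mcount-G₁-side (inj₁ y) (inj₁ x) tt tt refl refl =
    shifted-product (mcount G₁ x y) (mcount G₁ y x) (length (edges G₂)) (d₁ x u₁) (d₁ y u₁)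

  szegedTerm-G₂ : ∀ e → szegedTerm S (φ₂ e) ≡ szegedTerm G₂ e + length (edges G₁) * mroot G₂ u₂ e
  szegedTerm-G₂ (x , y) with π-ι x | π-ι y
  ... | π₁x≡u , π₂x≡x , ιx-vertex | π₁y≡u , π₂y≡y , ιy-vertex
    rewrite mcount-G₂-side (ι x) (ι y) ιx-vertex ιy-vertex π₁x≡u π₁y≡u
          | mcount-G₂-side (ι y) (ι x) ιy-vertex ιx-vertex π₁y≡u π₁x≡u | π₂x≡x | π₂y≡y =
    shifted-product (mcount G₂ x y) (mcount G₂ y x) (length (edges G₁)) (d₂ x u₂) (d₂ y u₂)

  side-sum : ∀ (G : Graph) (φ : Graph.V G × Graph.V G → Vert × Vert) (r : Graph.V G) (E : ℕ)
           → (∀ e → szegedTerm S (φ e) ≡ szegedTerm G e + E * mroot G r e)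
           → sumOf (λ e → szegedTerm S (φ e)) (edges G) ≡ Sze G + E * sumOf (mroot G r) (edges G)
  side-sum G φ r E term = begin
    sumOf (λ e → szegedTerm S (φ e)) (edges G)                          ≡⟨ sumOf-cong (edges G) (λ e _ → term e) ⟩
    sumOf (λ e → szegedTerm G e + E * mroot G r e) (edges G)            ≡⟨ sumOf-+ (szegedTerm G) _ (edges G) ⟩
    sumOf (szegedTerm G) (edges G) + sumOf (λ e → E * mroot G r e) (edges G)
                                                                        ≡⟨ cong₂ _+_ (sym (Sze-sum G)) (sumOf-* E (mroot G r) (edges G)) ⟩
    Sze G + E * sumOf (mroot G r) (edges G)                             ∎
    where open ≡-Reasoning

proposition3 : (n₁ n₂ : ℕ) (a₁ : Fin n₁ → Fin n₁ → Bool) (a₂ : Fin n₂ → Fin n₂ → Bool)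
    → Symmetric a₁ → Irreflexive a₁ → Connected (FinGraph n₁ a₁)
    → Symmetric a₂ → Irreflexive a₂ → Connected (FinGraph n₂ a₂)
    → (u₁ : Fin n₁) (u₂ : Fin n₂)
    → Sze (splice n₁ n₂ a₁ a₂ u₁ u₂)
      ≡ Sze (FinGraph n₁ a₁) + Sze (FinGraph n₂ a₂)
        + length (edges (FinGraph n₂ a₂)) * sum (map (mroot (FinGraph n₁ a₁) u₁) (edges (FinGraph n₁ a₁)))
        + length (edges (FinGraph n₁ a₁)) * sum (map (mroot (FinGraph n₂ a₂) u₂) (edges (FinGraph n₂ a₂)))
proposition3 n₁ n₂ a₁ a₂ sym₁ _ conn₁ sym₂ _ conn₂ u₁ u₂ = begin
  Sze S                                                                ≡⟨ Sze-sum S ⟩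
  sumOf (szegedTerm S) (edges S)                                       ≡⟨ edgeSum-splice (szegedTerm S) szegedTerm-sym sym₂ ⟩
  sumOf (λ e → szegedTerm S (φ₁ e)) (edges G₁) + sumOf (λ e → szegedTerm S (φ₂ e)) (edges G₂)
    ≡⟨ cong₂ _+_ (side-sum G₁ φ₁ u₁ (length (edges G₂)) szegedTerm-G₁) (side-sum G₂ φ₂ u₂ (length (edges G₁)) szegedTerm-G₂) ⟩
  (Sze G₁ + Σm₁) + (Sze G₂ + Σm₂)                                      ≡⟨ interchange (Sze G₁) Σm₁ (Sze G₂) Σm₂ ⟩
  (Sze G₁ + Sze G₂) + (Σm₁ + Σm₂)                                      ≡⟨ sym (+-assoc (Sze G₁ + Sze G₂) Σm₁ Σm₂) ⟩
  Sze G₁ + Sze G₂ + Σm₁ + Σm₂                                          ∎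
  where
  open ≡-Reasoning
  open SpliceDistance n₁ n₂ a₁ a₂ sym₁ conn₁ sym₂ conn₂ u₁ u₂
  Σm₁ Σm₂ : ℕ
  Σm₁ = length (edges G₂) * sumOf (mroot G₁ u₁) (edges G₁)
  Σm₂ = length (edges G₁) * sumOf (mroot G₂ u₂) (edges G₂)
  szegedTerm-sym : ∀ v w → szegedTerm S (v , w) ≡ szegedTerm S (w , v)
  szegedTerm-sym v w = *-comm (mcount S v w) (mcount S w v)
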